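{- Let $H\in\mathcal{H}^+$ be a positive-Horn expression, let $h_1,\ldots,h_k$ be all the positive occurrences (occurrences of elements of $\mathcal{L}\cup\{\bot\}$ not under an overline) in $H$, and let $\Delta_i=\Delta(H,h_i)$. Then $H$ is strongly equivalent to $$H_\Delta=\textstyle\bigwedge\big[\ \bigvee(h_1\ \Delta_1)\ \ldots\ \bigvee(h_k\ \Delta_k)\ \big],$$ i.e. for every interpretation $I$ the reducts $H^I$ and $(H_\Delta)^I$ are logically equivalent.
   Context: Fix a set $\mathcal{A}$ of propositional atoms; $\mathcal{L}=\mathcal{A}\cup\{\neg a:a\in\mathcal{A}\}$ is the set of literals; for $\ell\in\mathcal{L}$, $\mathit{not}\,\ell$ is a default literal. Elementary expressions: $\mathcal{E}^1=\mathcal{L}\cup\{\mathit{not}\,\ell:\ell\in\mathcal{L}\}\cup\{\top,\bot\}$. For each $x\in\mathcal{E}^1$ there is a negative (overlined) elementary expression $\overline{x}$. Expressions are built from elementary and overlined elementary expressions with $\bigwedge[\varphi_1\ldots\varphi_k]$ and $\bigvee(\varphi_1\ldots\varphi_k)$. An interpretation is a set $I\subseteq\mathcal{L}$ containing no pair $a,\neg a$. Satisfaction: $I\models\top$, $I\not\models\bot$; $I\models\ell$ iff $\ell\in I$; $I\models\mathit{not}\,\ell$ iff $\ell\notin I$; $I\models\overline{x}$ iff $I\not\models x$; conjunction/disjunction as usual. Reduct w.r.t. $I$: $x^I=x$ for $x\in\mathcal{L}\cup\{\top,\bot\}$; $(\mathit{not}\,\ell)^I=\bot$ if $\ell\in I$,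 $\top$ otherwise; $(\overline{x})^I=\overline{x^I}$; reducts commute with $\bigwedge,\bigvee$. Two default-free expressions are logically equivalent if they are satisfied by exactly the same interpretations. Positive elements: members of $\mathcal{L}\cup\{\bot\}$. $\mathcal{N}$: expressions built by $\bigwedge,\bigvee$ in which every elementary occurrence is overlined. $\mathcal{H}^+$ (positive-Horn expressions) is the smallest set with: (1) $\mathcal{L}\cup\{\bot\}\subseteq\mathcal{H}^+$; (2) $\varphi_1,\ldots,\varphi_k\in\mathcal{H}^+\Rightarrow\bigwedge[\varphi_1\ldots\varphi_k]\in\mathcal{H}^+$; (3) if for some $i$, $\varphi_i\in\mathcal{H}^+$ and $\varphi_j\in\mathcal{N}$ for all $j\neq i$, then $\bigvee(\varphi_1\ldots\varphi_k)\in\mathcal{H}^+$. For $H\in\mathcal{H}^+$ and a fixed positive occurrence $h$, $\Delta(H,h)$ is defined recursively: if $H$ is this occurrence, $\Delta(H,h)=\bot$; if $H=\bigwedge[H_1\ldots H_k]$ with the occurrence in $H_i$, $\Delta(H,h)=\Delta(H_i,h)$; if $H=\bigvee(H_1\ldots H_k)$ with the occurrence in $H_i$, $\Delta(H,h)=\bigvee(H_1\ldots H_{i-1}\ \Delta(H_i,h)\ H_{i+1}\ldots H_k)$. -}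

module Defs where

open import Data.Bool using (Bool; true; false; _∧_; _∨_; not)
open import Data.List using (List; []; _∷_; _++_; map)
open import Data.List.Relation.Unary.All using (All)
open import Data.Maybe using (Maybe; just; nothing)
open import Data.Product using (_×_)
open import Relation.Binary.PropositionalEquality using (_≡_)
open import Relation.Nullary using (¬_)

module _ (Atom : Set) where

  data Lit : Set where
    pos : Atom → Lit
    neg : Atom → Lit

  data El : Set where
    lit  : Lit → El
    dnot : Lit → El
    ⊤E   : El
    ⊥E   : El

  data Expr : Set where
    el  : El → Expr
    ov  : El → Expr
    And : List Expr → Expr
    Or  : List Expr → Expr

  -- interpretations: a set I ⊆ L given by its characteristic function,
  -- containing no complementary pair
  Interp : Set
  Interp = Lit → Bool

  Consistent : Interp → Set
  Consistent I = ∀ a → ¬ (I (pos a) ≡ true × I (neg a) ≡ true)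

  satEl : Interp → El → Bool
  satEl I (lit l)  = I l
  satEl I (dnot l) = not (I l)
  satEl I ⊤E = true
  satEl I ⊥E = false

  mutual
    sat : Interp → Expr → Bool
    sat I (el x)   = satEl I x
    sat I (ov x)   = not (satEl I x)
    sat I (And es) = satAll I es
    sat I (Or es)  = satAny I es

    satAll : Interp → List Expr → Bool
    satAll I []       = true
    satAll I (e ∷ es) = sat I e ∧ satAll I es

    satAny : Interp → List Expr → Bool
    satAny I []       = false
    satAny I (e ∷ es) = sat I e ∨ satAny I es

  reductEl : Interp → El → El
  reductEl I (lit l)  = lit l
  reductEl I (dnot l) with I l
  ... | true  = ⊥E
  ... | false = ⊤E
  reductEl I ⊤E = ⊤E
  reductEl I ⊥E = ⊥E

  mutual
    reduct : Interp → Expr → Expr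
    reduct I (el x)   = el (reductEl I x)
    reduct I (ov x)   = ov (reductEl I x)
    reduct I (And es) = And (reductList I es)
    reduct I (Or es)  = Or (reductList I es)

    reductList : Interp → List Expr → List Expr
    reductList I []       = []
    reductList I (e ∷ es) = reduct I e ∷ reductList I es

  data PosEl : El → Set where
    pos-lit : ∀ l → PosEl (lit l)
    pos-⊥   : PosEl ⊥E

  posEl? : (x : El) → Maybe (PosEl x)
  posEl? (lit l)  = just (pos-lit l)
  posEl? (dnot l) = nothing
  posEl? ⊤E       = nothing
  posEl? ⊥E       = just pos-⊥

  data IsN : Expr → Set where
    n-ov  : ∀ x → IsN (ov x)
    n-and : ∀ {es} → All IsN es → IsN (And es)
    n-or  : ∀ {es} → All IsN es → IsN (Or es)

  data IsH+ : Expr → Set where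
    h-el  : ∀ {x} → PosEl x → IsH+ (el x)
    h-and : ∀ {es} → All IsH+ es → IsH+ (And es)
    h-or  : ∀ {xs φ ys} → All IsN xs → IsH+ φ → All IsN ys →
            IsH+ (Or (xs ++ φ ∷ ys))

  mutual
    data Occ : Expr → Set where
      here  : ∀ {x} → PosEl x → Occ (el x)
      inAnd : ∀ {es} → OccL es → Occ (And es)
      inOr  : ∀ {es} → OccL es → Occ (Or es)

    data OccL : List Expr → Set where
      hd : ∀ {e es} → Occ e → OccL (e ∷ es)
      tl : ∀ {e es} → OccL es → OccL (e ∷ es)

  mutual
    occEl : ∀ {e} → Occ e → El
    occEl (here {x} _) = x
    occEl (inAnd o) = occElL o
    occEl (inOr o)  = occElL o

    occElL : ∀ {es} → OccL es → El
    occElL (hd o) = occEl o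
    occElL (tl o) = occElL o

  mutual
    occs : (e : Expr) → List (Occ e)
    occs (el x) with posEl? x
    ... | just p  = here p ∷ []
    ... | nothing = []
    occs (ov x)   = []
    occs (And es) = map inAnd (occsL es)
    occs (Or es)  = map inOr (occsL es)

    occsL : (es : List Expr) → List (OccL es)
    occsL []       = []
    occsL (e ∷ es) = map hd (occs e) ++ map tl (occsL es)

  mutual
    Δ : (e : Expr) → Occ e → Expr
    Δ (el x)   (here _)  = el ⊥E
    Δ (And es) (inAnd o) = ΔAnd es o
    Δ (Or es)  (inOr o)  = Or (ΔOr es o)

    ΔAnd : (es : List Expr) → OccL es → Expr
    ΔAnd (e ∷ es) (hd o) = Δ e o
    ΔAnd (e ∷ es) (tl o) = ΔAnd es o

    ΔOr : (es : List Expr) → OccL es → List Expr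
    ΔOr (e ∷ es) (hd o) = Δ e o ∷ es
    ΔOr (e ∷ es) (tl o) = e ∷ ΔOr es o

  HΔ : Expr → Expr
  HΔ H = And (map (λ o → Or (el (occEl o) ∷ Δ H o ∷ [])) (occs H))

  -- logical equivalence (for default-free expressions)
  LogEquiv : Expr → Expr → Set
  LogEquiv φ ψ = ∀ (J : Interp) → Consistent J → sat J φ ≡ sat J ψ

  StronglyEquiv : Expr → Expr → Set
  StronglyEquiv φ ψ = ∀ (I : Interp) → Consistent I → LogEquiv (reduct I φ) (reduct I ψ)

{-# OPTIONS --safe #-}

-- Fix I and J. The map e ↦ (J ⊨ e^I) is a compositional Boolean evaluation
-- sending ⊥ to false, and the theorem holds for any such evaluation: by
-- induction on H ∈ H⁺, the value of H is the conjunction, over its positive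
-- occurrences h, of h ∨ Δ(H,h). For a conjunction the occurrence lists are
-- concatenated. For ⋁(xs φ ys) with xs, ys in N, those disjuncts carry no
-- positive occurrence, so they distribute over the conjunction of clauses of φ
-- and reappear in every Δ.

module Submission where

open import Defs
open import Algebra using (CommutativeMonoid)
open import Data.Bool using (Bool; _∧_; _∨_)
open import Data.Bool.ListAction using (and; all)
open import Data.Bool.Properties
  using (∧-assoc; ∧-identityʳ; ∨-assoc; ∨-identityʳ; ∨-zeroˡ; ∨-zeroʳ;
         ∨-distribˡ-∧; ∨-distribʳ-∧; ∨-commutativeMonoid)
open import Algebra.Properties.CommutativeSemigroup
  (CommutativeMonoid.commutativeSemigroup ∨-commutativeMonoid) using (x∙yz≈y∙xz)
open import Data.List using (List; []; _∷_; _++_; map)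
open import Data.List.Properties using (map-∘; map-cong)
open import Data.List.Relation.Unary.All using (All; []; _∷_)
open import Function using (_∘_)
open import Relation.Binary.PropositionalEquality
  using (_≡_; _≗_; refl; sym; trans; cong; cong₂; module ≡-Reasoning)

open ≡-Reasoning

module _ {A : Set} where

  all-++ : (f : A → Bool) (xs ys : List A) → all f (xs ++ ys) ≡ all f xs ∧ all f ys
  all-++ f []       ys = refl
  all-++ f (x ∷ xs) ys = trans (cong (f x ∧_) (all-++ f xs ys)) (sym (∧-assoc (f x) _ _))

  all-map : {B : Set} (f : B → Bool) (g : A → B) (xs : List A) →
            all f (map g xs) ≡ all (f ∘ g) xs
  all-map f g xs = cong and (sym (map-∘ xs))

  all-cong : {f g : A → Bool} → f ≗ g → all f ≗ all g
  all-cong f≗g xs = cong and (map-cong f≗g xs)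

  ∨-distribˡ-all : (b : Bool) (f : A → Bool) (xs : List A) →
                   b ∨ all f xs ≡ all ((b ∨_) ∘ f) xs
  ∨-distribˡ-all b f []       = ∨-zeroʳ b
  ∨-distribˡ-all b f (x ∷ xs) =
    trans (∨-distribˡ-∧ b (f x) _) (cong ((b ∨ f x) ∧_) (∨-distribˡ-all b f xs))

  ∨-distribʳ-all : (b : Bool) (f : A → Bool) (xs : List A) →
                   all f xs ∨ b ≡ all ((_∨ b) ∘ f) xs
  ∨-distribʳ-all b f []       = ∨-zeroˡ b
  ∨-distribʳ-all b f (x ∷ xs) =
    trans (∨-distribʳ-∧ b (f x) _) (cong ((f x ∨ b) ∧_) (∨-distribʳ-all b f xs))

module _ {Atom : Set} where

  mutual
    occs-N : {e : Expr Atom} → IsN Atom e → occs Atom e ≡ []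
    occs-N (n-ov x)  = refl
    occs-N (n-and n) = cong (map inAnd) (occsL-N n)
    occs-N (n-or n)  = cong (map inOr) (occsL-N n)

    occsL-N : {es : List (Expr Atom)} → All (IsN Atom) es → occsL Atom es ≡ []
    occsL-N []       = refl
    occsL-N (n ∷ ns) = cong₂ (λ os osL → map hd os ++ map tl osL) (occs-N n) (occsL-N ns)

  all-occsL-∷ : (e : Expr Atom) (es : List (Expr Atom)) (f : OccL Atom (e ∷ es) → Bool) →
                all f (occsL Atom (e ∷ es)) ≡
                all (f ∘ hd) (occs Atom e) ∧ all (f ∘ tl) (occsL Atom es)
  all-occsL-∷ e es f =
    trans (all-++ f (map (hd {es = es}) (occs Atom e)) (map (tl {e = e}) (occsL Atom es)))
          (cong₂ _∧_ (all-map f hd (occs Atom e)) (all-map f tl (occsL Atom es)))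

  all-occsL-N∷ : {e : Expr Atom} (es : List (Expr Atom)) → IsN Atom e →
                 (f : OccL Atom (e ∷ es) → Bool) →
                 all f (occsL Atom (e ∷ es)) ≡ all (f ∘ tl) (occsL Atom es)
  all-occsL-N∷ {e} es n f =
    trans (all-occsL-∷ e es f) (cong (λ os → all (f ∘ hd) os ∧ all (f ∘ tl) (occsL Atom es))
                                 (occs-N n))

  all-occsL-∷N : (e : Expr Atom) {es : List (Expr Atom)} → All (IsN Atom) es →
                 (f : OccL Atom (e ∷ es) → Bool) →
                 all f (occsL Atom (e ∷ es)) ≡ all (f ∘ hd) (occs Atom e)
  all-occsL-∷N e {es} ns f =
    trans (all-occsL-∷ e es f)
          (trans (cong (λ os → all (f ∘ hd) (occs Atom e) ∧ all (f ∘ tl) os) (occsL-N ns))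
                 (∧-identityʳ _))

module _ {Atom : Set} (I J : Interp Atom) where

  ⟦_⟧ : Expr Atom → Bool
  ⟦ e ⟧ = sat Atom J (reduct Atom I e)

  ⟦And⟧ : (es : List (Expr Atom)) → ⟦ And es ⟧ ≡ all ⟦_⟧ es
  ⟦And⟧ []       = refl
  ⟦And⟧ (e ∷ es) = cong (⟦ e ⟧ ∧_) (⟦And⟧ es)

  clause : (e : Expr Atom) → Occ Atom e → Bool
  clause e o = ⟦ el (occEl Atom o) ⟧ ∨ ⟦ Δ Atom e o ⟧

  clauseAnd : (es : List (Expr Atom)) → OccL Atom es → Bool
  clauseAnd es o = ⟦ el (occElL Atom o) ⟧ ∨ ⟦ ΔAnd Atom es o ⟧

  clauseOr : (es : List (Expr Atom)) → OccL Atom es → Bool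
  clauseOr es o = ⟦ el (occElL Atom o) ⟧ ∨ ⟦ Or (ΔOr Atom es o) ⟧

  ⟦HΔ⟧ : (H : Expr Atom) → ⟦ HΔ Atom H ⟧ ≡ all (clause H) (occs Atom H)
  ⟦HΔ⟧ H =
    trans (⟦And⟧ (map clauseExpr (occs Atom H)))
          (trans (all-map ⟦_⟧ clauseExpr (occs Atom H))
                 (all-cong (λ o → cong (⟦ el (occEl Atom o) ⟧ ∨_) (∨-identityʳ ⟦ Δ Atom H o ⟧))
                           (occs Atom H)))
    where
    clauseExpr : Occ Atom H → Expr Atom
    clauseExpr o = Or (el (occEl Atom o) ∷ Δ Atom H o ∷ [])

  mutual
    ⟦⟧≡all-clause : {e : Expr Atom} → IsH+ Atom e → ⟦ e ⟧ ≡ all (clause e) (occs Atom e)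
    ⟦⟧≡all-clause (h-el (pos-lit l)) = sym (trans (∧-identityʳ _) (∨-identityʳ _))
    ⟦⟧≡all-clause (h-el pos-⊥)       = refl
    ⟦⟧≡all-clause (h-and {es} hs) =
      trans (⟦And⟧≡all-clauseAnd hs) (sym (all-map (clause (And es)) inAnd (occsL Atom es)))
    ⟦⟧≡all-clause (h-or {xs} {φ} {ys} nxs h nys) =
      trans (⟦Or⟧≡all-clauseOr nxs h nys) (sym (all-map (clause (Or es)) inOr (occsL Atom es)))
      where es = xs ++ φ ∷ ys

    ⟦And⟧≡all-clauseAnd : {es : List (Expr Atom)} → All (IsH+ Atom) es →
                          ⟦ And es ⟧ ≡ all (clauseAnd es) (occsL Atom es)
    ⟦And⟧≡all-clauseAnd []       = refl
    ⟦And⟧≡all-clauseAnd {e ∷ es} (h ∷ hs) =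
      trans (cong₂ _∧_ (⟦⟧≡all-clause h) (⟦And⟧≡all-clauseAnd hs))
            (sym (all-occsL-∷ e es (clauseAnd (e ∷ es))))

    -- ⟦ Or (e ∷ es) ⟧ unfolds to ⟦ e ⟧ ∨ ⟦ Or es ⟧, so clauseOr at hd o (resp. tl o) is
    -- clause φ o ∨ ⟦ Or ys ⟧ (resp. ⟦ x ⟧ ∨ clauseOr es o) up to reassociation.
    ⟦Or⟧≡all-clauseOr : {xs : List (Expr Atom)} {φ : Expr Atom} {ys : List (Expr Atom)} →
                        All (IsN Atom) xs → IsH+ Atom φ → All (IsN Atom) ys →
                        ⟦ Or (xs ++ φ ∷ ys) ⟧ ≡
                        all (clauseOr (xs ++ φ ∷ ys)) (occsL Atom (xs ++ φ ∷ ys))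
    ⟦Or⟧≡all-clauseOr {[]} {φ} {ys} [] h nys = begin
      ⟦ φ ⟧ ∨ ⟦ Or ys ⟧
        ≡⟨ cong (_∨ ⟦ Or ys ⟧) (⟦⟧≡all-clause h) ⟩
      all (clause φ) (occs Atom φ) ∨ ⟦ Or ys ⟧
        ≡⟨ ∨-distribʳ-all ⟦ Or ys ⟧ (clause φ) (occs Atom φ) ⟩
      all (λ o → clause φ o ∨ ⟦ Or ys ⟧) (occs Atom φ)
        ≡⟨ all-cong (λ o → ∨-assoc ⟦ el (occEl Atom o) ⟧ ⟦ Δ Atom φ o ⟧ ⟦ Or ys ⟧) (occs Atom φ) ⟩
      all (clauseOr (φ ∷ ys) ∘ hd) (occs Atom φ)
        ≡⟨ all-occsL-∷N φ nys (clauseOr (φ ∷ ys)) ⟨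
      all (clauseOr (φ ∷ ys)) (occsL Atom (φ ∷ ys))
        ∎
    ⟦Or⟧≡all-clauseOr {x ∷ xs} {φ} {ys} (n ∷ nxs) h nys = begin
      ⟦ x ⟧ ∨ ⟦ Or es ⟧
        ≡⟨ cong (⟦ x ⟧ ∨_) (⟦Or⟧≡all-clauseOr nxs h nys) ⟩
      ⟦ x ⟧ ∨ all (clauseOr es) (occsL Atom es)
        ≡⟨ ∨-distribˡ-all ⟦ x ⟧ (clauseOr es) (occsL Atom es) ⟩
      all (λ o → ⟦ x ⟧ ∨ clauseOr es o) (occsL Atom es)
        ≡⟨ all-cong (λ o → x∙yz≈y∙xz ⟦ x ⟧ ⟦ el (occElL Atom o) ⟧ ⟦ Or (ΔOr Atom es o) ⟧)
                    (occsL Atom es) ⟩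
      all (clauseOr (x ∷ es) ∘ tl) (occsL Atom es)
        ≡⟨ all-occsL-N∷ es n (clauseOr (x ∷ es)) ⟨
      all (clauseOr (x ∷ es)) (occsL Atom (x ∷ es))
        ∎
      where es = xs ++ φ ∷ ys

theorem3 : (Atom : Set) (H : Expr Atom) → IsH+ Atom H →
    StronglyEquiv Atom H (HΔ Atom H)
theorem3 Atom H h I _ J _ = trans (⟦⟧≡all-clause I J h) (sym (⟦HΔ⟧ I J H))
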